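{- Let $1\le\ell\le k-1$ be integers such that $k-\ell$ does not divide $k$, and let $R$ be an $\ell$-connected $k$-graph. Then there is a $k$-partite $k$-uniform $\ell$-cycle $C$ with at most $k^4$ edges such that the lattice $\mathcal L_C(R)$ is complete.
   Context: A $k$-graph has a vertex set and $k$-element edges; it is $k$-partite if its vertex set can be partitioned into $k$ parts with every edge meeting each part in exactly one vertex. An $\ell$-cycle is a $k$-graph with cyclically ordered vertices, every edge consisting of $k$ consecutive vertices and consecutive edges meeting in exactly $\ell$ vertices. The $\ell$-line graph of $R$ is the graph on $E(R)$ with $e\sim f$ iff $|e\cap f|\ge\ell$; $R$ is $\ell$-connected if it has no isolated vertices and its edges are connected in the $\ell$-line graph. A homomorphism $\phi:F\to R$ is a map $V(F)\to V(R)$ sending edges to edges; its indicator vector $\mathbf 1_\phi\in\mathbb N^{V(R)}$ is $\mathbf 1_\phi(v)=|\phi^{ -1}(v)|$. The $F$-lattice $\mathcal L_F(R)\subseteq\mathbb Z^{V(R)}$ is the additive subgroup generated by all $\mathbf 1_\phi$, $\phi$ a homomorphism from $F$ to $R$. It is complete if it contains every $\mathbf b\in\mathbb Z^{V(R)}$ with $\sum_v\mathbf b(v)$ divisible by $|V(F)|$. -}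

module Defs where

open import Data.Nat as ℕ using (ℕ; zero; suc; _+_; _*_; _∸_; _<_; _<?_; _≤_)
open import Data.Nat.DivMod using (_%_)
open import Data.Integer as ℤ using (ℤ; +_)
open import Data.Fin as Fin using (Fin; toℕ)
open import Data.Fin.Subset using (Subset; _∈_; _∩_; ∣_∣)
open import Data.Vec using (tabulate)
open import Data.List using (List; map; foldr; allFin)
open import Data.List.Relation.Unary.All using (All)
open import Data.List.Relation.Unary.Any using (Any)
open import Data.Product using (Σ; ∃; _×_; _,_; proj₁; proj₂)
open import Relation.Binary.PropositionalEquality using (_≡_)
open import Relation.Nullary using (does)
open import Function.Bundles using (_⇔_)

record Graph : Set where
  constructor mkGraph
  field
    n : ℕ
    E : List (Subset n)
open Graph public

_∈E_ : {m : ℕ} → Subset m → List (Subset m) → Set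
e ∈E es = Any (e ≡_) es

Uniform : ℕ → Graph → Set
Uniform k G = All (λ e → ∣ e ∣ ≡ k) (E G)

KPartite : ℕ → Graph → Set
KPartite k G = Σ (Fin (n G) → Fin k) λ part →
  All (λ e → (i : Fin k) → Σ (Fin (n G)) λ u →
         u ∈ e × part u ≡ i × ((w : Fin (n G)) → w ∈ e → part w ≡ i → w ≡ u))
      (E G)

data LWalk (ℓ : ℕ) {m : ℕ} (es : List (Subset m)) : Subset m → Subset m → Set where
  here : ∀ {e} → LWalk ℓ es e e
  step : ∀ {e g f} → g ∈E es → ℓ ≤ ∣ e ∩ g ∣ → LWalk ℓ es g f → LWalk ℓ es e f

LConnected : ℕ → Graph → Set
LConnected ℓ G =
  ((v : Fin (n G)) → Any (λ e → v ∈ e) (E G)) ×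
  (∀ e f → e ∈E E G → f ∈E E G → LWalk ℓ (E G) e f)

_imageIs_under_ : {a b : ℕ} → Subset b → Subset a → (Fin a → Fin b) → Set
_imageIs_under_ {a} f e φ = ∀ v → (v ∈ f) ⇔ (Σ (Fin a) λ u → u ∈ e × φ u ≡ v)

IsHom : (F R : Graph) → (Fin (n F) → Fin (n R)) → Set
IsHom F R φ = All (λ e → Any (λ f → f imageIs e under φ) (E R)) (E F)

Hom : Graph → Graph → Set
Hom F R = Σ (Fin (n F) → Fin (n R)) (IsHom F R)

-- Indicator vector 1_φ(v) = |φ⁻¹(v)|.
ind : (F R : Graph) → Hom F R → Fin (n R) → ℤ
ind F R (φ , _) v = + ∣ tabulate (λ u → does (φ u Fin.≟ v)) ∣

sumℤ : List ℤ → ℤ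
sumℤ = foldr ℤ._+_ (+ 0)

InLattice : (F R : Graph) → (Fin (n R) → ℤ) → Set
InLattice F R b = Σ (List (ℤ × Hom F R)) λ cs →
  ∀ v → b v ≡ sumℤ (map (λ p → proj₁ p ℤ.* ind F R (proj₂ p) v) cs)

Complete : (F R : Graph) → Set
Complete F R = (b : Fin (n R) → ℤ) →
  (+ n F) ∣ sumℤ (map b (allFin (n R))) → InLattice F R b
  where open import Data.Integer.Divisibility using (_∣_)

-- x mod N (with x mod 0 = x, never used since N > 0 below).
_mod'_ : ℕ → ℕ → ℕ
x mod' zero = x
x mod' suc N = x % suc N

-- The (standard) k-uniform ℓ-cycle with m edges: vertices 0..N-1 (N = m(k-ℓ))
-- in cyclic order; edge i consists of the k consecutive vertices
-- s_i, s_i+1, ..., s_i+k-1 (mod N), where s_i = i(k-ℓ) mod N.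
cycN : ℕ → ℕ → ℕ → ℕ
cycN k ℓ m = m * (k ∸ ℓ)

cycEdge : (k ℓ m : ℕ) → ℕ → Subset (cycN k ℓ m)
cycEdge k ℓ m i = tabulate λ v →
  does (((toℕ v + N) ∸ ((i * (k ∸ ℓ)) mod' N)) mod' N <? k)
  where N = cycN k ℓ m

cycle : (k ℓ m : ℕ) → Graph
cycle k ℓ m = mkGraph (cycN k ℓ m) (map (λ i → cycEdge k ℓ m (toℕ i)) (allFin m))

-- consecutive edges (cyclically, edge m-1 followed by edge 0) meet in exactly ℓ vertices
ConsecutiveMeet : (k ℓ m : ℕ) → Set
ConsecutiveMeet k ℓ m = (i : ℕ) → i < m →
  ∣ cycEdge k ℓ m i ∩ cycEdge k ℓ m (suc i) ∣ ≡ ℓ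

-- Write d = k − ℓ and k = q·d + r; then 0 < r < d since d ∤ k.  In the ℓ-cycle with m edges,
-- vertex a·d + s lies in block a at position s, and every edge consists of k consecutive
-- vertices starting at a block boundary, so it meets position s in p_s consecutive blocks,
-- where p_s = q + 1 for s < r and p_s = q otherwise.  If q and q + 1 divide m, colouring
-- a·d + s with (a mod p_s)·d + s makes every edge rainbow, and the colours r and 0 are used
-- m/q and m/(q + 1) times; for m = q(q + 1) these are q + 1 and q.  (If q = 1 that cycle is
-- degenerate; then m = 4 and a recolouring of the blocks 0 and 3 gives classes of sizes 3
-- and 2.)
-- Mapping the cycle onto an edge f of R colour by colour, and then swapping two colour
-- classes whose sizes differ by one, gives two homomorphisms whose indicator vectors differ
-- by e_x − e_y, for any x, y ∈ f.  As ℓ ≥ 1, ℓ-connectivity chains these to all pairs of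
-- vertices, and together with one indicator vector, whose entries sum to n(C), these
-- differences generate every vector whose sum is divisible by n(C).

module Submission where

open import Defs
open import Data.Nat using (ℕ; _≤_; _<_; _∸_; _^_)
open import Data.Nat.Divisibility using (_∣_)
open import Data.Product using (Σ; _×_)
open import Relation.Nullary using (¬_)
open import Data.Nat.Base using (>-nonZero⁻¹)
open import Data.Product using (_,_)

module Enumerations where

  open import Data.Bool.Base using (Bool; true)
  open import Data.Fin.Base using (Fin; zero; suc; punchOut)
  open import Data.Fin.Permutation using (Permutation′; _⟨$⟩ʳ_; _⟨$⟩ˡ_; _∘ₚ_; transpose; inverseʳ)
  import Data.Fin.Permutation.Components as PC
  open import Data.Fin.Properties
    using (_≟_; any?; suc-injective; punchOut-injective; injective⇒≤; cantor-schröder-bernstein)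
  open import Data.Fin.Subset using (Subset; _∈_; ∣_∣; inside; outside; Nonempty)
  open import Data.Fin.Subset.Properties using (nonempty?; Empty-unique; ∣⊥∣≡0)
  open import Data.List.Relation.Unary.All as All using (All)
  open import Data.List.Relation.Unary.Any as Any using (Any)
  open import Data.Nat.Base using (ℕ; zero; suc; _<_)
  open import Data.Nat.Properties using (1+n≰n; >⇒≢)
  open import Data.Product.Base as Product using (Σ; ∃; _×_; _,_; proj₁; proj₂)
  open import Data.Vec.Base using ([]; _∷_; here; there; tabulate)
  open import Data.Vec.Properties using ([]=⇒lookup; lookup⇒[]=; lookup∘tabulate; tabulate-cong)
  open import Function.Base using (_∘_)
  open import Function.Bundles using (_⇔_; mk⇔; Equivalence; Injection)
  open import Function.Definitions using (Injective)
  open import Function.Properties.Inverse using (↔⇒↣)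
  open import Relation.Binary.PropositionalEquality
  open import Relation.Nullary using (does; yes; no; contradiction)
  open import Relation.Nullary.Decidable using (dec-true; dec-false)

  private
    variable
      a b k m : ℕ

  record Enumeration (k : ℕ) (p : Subset m) : Set where
    field
      point : Fin k → Fin m
      point-injective : Injective _≡_ _≡_ point
      point∈ : ∀ j → point j ∈ p
      ∈⇒point : ∀ {v} → v ∈ p → ∃ λ j → point j ≡ v

  open Enumeration

  private module _ {p : Subset m} (e : Enumeration k p) where

    skip : Enumeration k (outside ∷ p)
    skip = record
      { point = suc ∘ point e
      ; point-injective = point-injective e ∘ suc-injective
      ; point∈ = there ∘ point∈ e
      ; ∈⇒point = λ { (there v∈p) → Product.map₂ (cong suc) (∈⇒point e v∈p) }
      }

    keep : Enumeration (suc k) (inside ∷ p)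
    keep = record
      { point = point′
      ; point-injective = injective′
      ; point∈ = λ { zero → here ; (suc j) → there (point∈ e j) }
      ; ∈⇒point = λ { here → zero , refl
                    ; (there v∈p) → Product.map suc (cong suc) (∈⇒point e v∈p) }
      }
      where
      point′ : Fin (suc k) → Fin (suc m)
      point′ zero = zero
      point′ (suc j) = suc (point e j)
      injective′ : Injective _≡_ _≡_ point′
      injective′ {zero} {zero} _ = refl
      injective′ {suc i} {suc j} eq = cong suc (point-injective e (suc-injective eq))

  enumerate : (p : Subset m) → Enumeration ∣ p ∣ p
  enumerate [] = record
    { point = λ () ; point-injective = λ { {()} } ; point∈ = λ () ; ∈⇒point = λ () }
  enumerate (outside ∷ p) = skip (enumerate p)
  enumerate (inside ∷ p) = keep (enumerate p)

  enumerate-sized : ∀ {p : Subset m} → ∣ p ∣ ≡ k → Enumeration k p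
  enumerate-sized {p = p} refl = enumerate p

  enumeration-size-unique : ∀ {k′} {p : Subset m} → Enumeration k p → Enumeration k′ p → k ≡ k′
  enumeration-size-unique e e′ =
    cantor-schröder-bernstein (reindex-injective e e′) (reindex-injective e′ e)
    where
    reindex-injective : ∀ {k k′} {p : Subset m} (e : Enumeration k p) (e′ : Enumeration k′ p) →
                        Injective _≡_ _≡_ (λ j → proj₁ (∈⇒point e′ (point∈ e j)))
    reindex-injective e e′ {i} {j} eq = point-injective e (begin
      point e i                                  ≡⟨ proj₂ (∈⇒point e′ (point∈ e i)) ⟨
      point e′ (proj₁ (∈⇒point e′ (point∈ e i))) ≡⟨ cong (point e′) eq ⟩
      point e′ (proj₁ (∈⇒point e′ (point∈ e j))) ≡⟨ proj₂ (∈⇒point e′ (point∈ e j)) ⟩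
      point e j                                  ∎)
      where open ≡-Reasoning

  enumeration-size : ∀ {p : Subset m} → Enumeration k p → ∣ p ∣ ≡ k
  enumeration-size {p = p} = enumeration-size-unique (enumerate p)

  permutation-injective : ∀ (σ : Permutation′ m) → Injective _≡_ _≡_ (σ ⟨$⟩ʳ_)
  permutation-injective σ = Injection.injective (↔⇒↣ σ)

  permute : ∀ {p : Subset m} → Enumeration k p → Permutation′ k → Enumeration k p
  permute e σ = record
    { point = point e ∘ (σ ⟨$⟩ʳ_)
    ; point-injective = permutation-injective σ ∘ point-injective e
    ; point∈ = point∈ e ∘ (σ ⟨$⟩ʳ_)
    ; ∈⇒point = λ v∈p → let j , ej≡v = ∈⇒point e v∈p in
        σ ⟨$⟩ˡ j , trans (cong (point e) (inverseʳ σ)) ej≡v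
    }

  injective⇒surjective : ∀ {f : Fin m → Fin m} → Injective _≡_ _≡_ f → ∀ c → ∃ λ j → f j ≡ c
  injective⇒surjective {suc m} {f} f-injective c with any? (λ j → f j ≟ c)
  ... | yes hit = hit
  ... | no miss = contradiction (injective⇒≤ punched-injective) 1+n≰n
    where
    c≢f : ∀ j → c ≢ f j
    c≢f j c≡fj = miss (j , sym c≡fj)
    punched-injective : Injective _≡_ _≡_ (λ j → punchOut (c≢f j))
    punched-injective {i} {j} eq = f-injective (punchOut-injective (c≢f i) (c≢f j) eq)

  transpose-matchˡ : ∀ (i j : Fin m) → PC.transpose i j i ≡ j
  transpose-matchˡ i j rewrite dec-true (i ≟ i) refl = refl

  transpose-matchʳ : ∀ (i j : Fin m) → PC.transpose i j j ≡ i
  transpose-matchʳ i j with j ≟ i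
  ... | yes refl = refl
  ... | no j≢i rewrite dec-true (j ≟ j) refl = refl

  transpose-mismatch : ∀ {i j l : Fin m} → l ≢ i → l ≢ j → PC.transpose i j l ≡ l
  transpose-mismatch {i = i} {j} {l} l≢i l≢j
    rewrite dec-false (l ≟ i) l≢i | dec-false (l ≟ j) l≢j = refl

  permutation-sending-pair : ∀ {c₁ c₂ a b : Fin m} → c₁ ≢ c₂ → a ≢ b →
                             ∃ λ (σ : Permutation′ m) → σ ⟨$⟩ʳ c₁ ≡ a × σ ⟨$⟩ʳ c₂ ≡ b
  permutation-sending-pair {c₁ = c₁} {c₂} {a} {b} c₁≢c₂ a≢b =
    transpose c₁ a ∘ₚ transpose a′ b , σc₁≡a , transpose-matchˡ a′ b
    where
    a′ = PC.transpose c₁ a c₂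
    σc₁≡a : PC.transpose a′ b (PC.transpose c₁ a c₁) ≡ a
    σc₁≡a rewrite transpose-matchˡ c₁ a = transpose-mismatch a≢a′ a≢b
      where
      a≢a′ : a ≢ a′
      a≢a′ a≡a′ =
        c₁≢c₂ (permutation-injective (transpose c₁ a) (trans (transpose-matchˡ c₁ a) a≡a′))

  ∈-tabulate⁺ : ∀ {P : Fin m → Bool} {v} → P v ≡ true → v ∈ tabulate P
  ∈-tabulate⁺ {P = P} {v} Pv = lookup⇒[]= v (tabulate P) (trans (lookup∘tabulate P v) Pv)

  ∈-tabulate⁻ : ∀ {P : Fin m → Bool} {v} → v ∈ tabulate P → P v ≡ true
  ∈-tabulate⁻ {P = P} {v} v∈P = trans (sym (lookup∘tabulate P v)) ([]=⇒lookup v∈P)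

  pre : (Fin a → Fin b) → Fin b → Subset a
  pre φ v = tabulate (λ u → does (φ u ≟ v))

  pre-cong : ∀ {b′} {φ : Fin a → Fin b} {ψ : Fin a → Fin b′} {v w} →
             (∀ u → φ u ≡ v ⇔ ψ u ≡ w) → pre φ v ≡ pre ψ w
  pre-cong {φ = φ} {ψ} {v} {w} φ⇔ψ = tabulate-cong does-≡
    where
    does-≡ : ∀ u → does (φ u ≟ v) ≡ does (ψ u ≟ w)
    does-≡ u with φ u ≟ v | ψ u ≟ w
    ... | yes _ | yes _ = refl
    ... | no _ | no _ = refl
    ... | yes φu≡v | no ψu≢w = contradiction (Equivalence.to (φ⇔ψ u) φu≡v) ψu≢w
    ... | no φu≢v | yes ψu≡w = contradiction (Equivalence.from (φ⇔ψ u) ψu≡w) φu≢v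

  ∈pre⁺ : ∀ {φ : Fin a → Fin b} {u v} → φ u ≡ v → u ∈ pre φ v
  ∈pre⁺ {φ = φ} {u} {v} φu≡v = ∈-tabulate⁺ (dec-true (φ u ≟ v) φu≡v)

  ∈pre⁻ : ∀ {φ : Fin a → Fin b} {u v} → u ∈ pre φ v → φ u ≡ v
  ∈pre⁻ {φ = φ} {u} {v} u∈pre with φ u ≟ v | ∈-tabulate⁻ u∈pre
  ... | yes φu≡v | _ = φu≡v

  pre-enumeration : ∀ (φ : Fin a → Fin b) {v} (g : Fin k → Fin a) → Injective _≡_ _≡_ g →
                    (∀ j → φ (g j) ≡ v) → (∀ {u} → φ u ≡ v → ∃ λ j → g j ≡ u) →
                    Enumeration k (pre φ v)
  pre-enumeration φ g g-injective φg≡v φ≡v⇒g = record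
    { point = g
    ; point-injective = g-injective
    ; point∈ = λ j → ∈pre⁺ {φ = φ} (φg≡v j)
    ; ∈⇒point = φ≡v⇒g ∘ ∈pre⁻ {φ = φ}
    }

  pre-∘-injective : ∀ {β : Fin b → Fin m} (φ : Fin a → Fin b) → Injective _≡_ _≡_ β →
                    ∀ c → pre (β ∘ φ) (β c) ≡ pre φ c
  pre-∘-injective {β = β} φ β-injective c = pre-cong (λ u → mk⇔ β-injective (cong β))

  ∣p∣>0⇒nonempty : ∀ {p : Subset m} → 0 < ∣ p ∣ → Nonempty p
  ∣p∣>0⇒nonempty {m} {p} 0<∣p∣ with nonempty? p
  ... | yes nonempty = nonempty
  ... | no empty = contradiction (trans (cong ∣_∣ (Empty-unique empty)) (∣⊥∣≡0 m)) (>⇒≢ 0<∣p∣)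

  RainbowEdge : (Fin m → Fin k) → Subset m → Set
  RainbowEdge {k = k} φ e = Σ (Enumeration k e) λ w → Injective _≡_ _≡_ (φ ∘ point w)

  Rainbow : (C : Graph) → (Fin (n C) → Fin k) → Set
  Rainbow C φ = All (RainbowEdge φ) (E C)

  module _ (C : Graph) (φ : Fin (n C) → Fin k) (rainbow : Rainbow C φ) where

    rainbow⇒kPartite : KPartite k C
    rainbow⇒kPartite = φ , All.map colour-class rainbow
      where
      colour-class : ∀ {e} → RainbowEdge φ e → (i : Fin k) →
                     Σ (Fin (n C)) λ u → u ∈ e × φ u ≡ i × (∀ x → x ∈ e → φ x ≡ i → x ≡ u)
      colour-class (w , φw-injective) i =
        let j , φwj≡i = injective⇒surjective φw-injective i in
        point w j , point∈ w j , φwj≡i , unique j φwj≡i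
        where
        unique : ∀ j → φ (point w j) ≡ i → ∀ x → x ∈ _ → φ x ≡ i → x ≡ point w j
        unique j φwj≡i x x∈e φx≡i with ∈⇒point w x∈e
        ... | j′ , refl = cong (point w) (φw-injective (trans φx≡i (sym φwj≡i)))

    rainbow-hom : ∀ (R : Graph) {f} → Enumeration k f → f ∈E E R → Hom C R
    rainbow-hom R {f} β f∈R =
      point β ∘ φ , All.map (λ edge → Any.map (λ { refl → image edge }) f∈R) rainbow
      where
      image : ∀ {e} → RainbowEdge φ e → f imageIs e under (point β ∘ φ)
      image {e} (w , φw-injective) v = mk⇔ to λ { (u , _ , refl) → point∈ β (φ u) }
        where
        to : v ∈ f → Σ (Fin (n C)) λ u → u ∈ e × point β (φ u) ≡ v
        to v∈f with ∈⇒point β v∈f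
        ... | c , refl with injective⇒surjective φw-injective c
        ... | j , φwj≡c = point w j , point∈ w j , cong (point β) φwj≡c

module Lattices where

  open Enumerations
  open import Data.Bool.Base using (if_then_else_)
  open import Data.Fin.Base using (Fin; zero; suc)
  open import Data.Fin.Permutation using (transpose)
  open import Data.Fin.Properties using (_≟_)
  open import Data.Fin.Subset using (_∈_; ∣_∣)
  open import Data.Fin.Subset.Properties using (x∈p∩q⁻)
  open import Data.Integer.Base using (ℤ; +_; 0ℤ; 1ℤ; -1ℤ; _+_; _*_; -_; _-_)
  import Data.Integer.Divisibility.Signed as Signed
  import Data.Integer.Properties as ℤP
  open import Algebra.Properties.Semiring.Sum ℤP.+-*-semiring
    using (sum; sum-cong-≗; sum-replicate-zero; ∑-distrib-+; *-distribʳ-sum)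
  open import Data.Integer.Tactic.RingSolver using (solve-∀)
  open import Data.List.Base using (List; []; _∷_; map; _++_; tabulate)
  open import Data.List.Membership.Propositional using (find)
  open import Data.List.Relation.Unary.All as All using ()
  open import Data.Nat.Base using (ℕ; zero; suc; _≤_)
  open import Data.Nat.Properties using (≤-trans; 1+n≢n)
  open import Data.Product.Base as Product using (_×_; _,_; proj₁; proj₂)
  open import Function.Base using (_∘_; id; const)
  open import Function.Bundles using (_⇔_; mk⇔)
  open import Relation.Binary.PropositionalEquality
  open import Relation.Nullary using (Dec; does; yes; no; contradiction)

  private
    variable
      a b k m : ℕ

  open Enumeration

  δ : Fin m → Fin m → ℤ
  δ u v = if does (u ≟ v) then 1ℤ else 0ℤ

  sum-zero : ∀ {f : Fin m → ℤ} → (∀ u → f u ≡ 0ℤ) → sum f ≡ 0ℤ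
  sum-zero {m = m} f≗0 = trans (sum-cong-≗ f≗0) (sum-replicate-zero m)

  sumℤ-map-tabulate : ∀ {A : Set} (b : A → ℤ) (g : Fin m → A) →
                      sumℤ (map b (tabulate g)) ≡ sum (b ∘ g)
  sumℤ-map-tabulate {m = zero} b g = refl
  sumℤ-map-tabulate {m = suc m} b g = cong (_+_ (b (g zero))) (sumℤ-map-tabulate b (g ∘ suc))

  δ-comm : ∀ (u v : Fin m) → δ u v ≡ δ v u
  δ-comm u v with u ≟ v | v ≟ u
  ... | yes _ | yes _ = refl
  ... | no _ | no _ = refl
  ... | yes u≡v | no v≢u = contradiction (sym u≡v) v≢u
  ... | no u≢v | yes v≡u = contradiction (sym v≡u) u≢v

  sum-δ : ∀ (b : Fin m → ℤ) v → sum (λ u → b u * δ u v) ≡ b v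
  sum-δ {m = suc m} b zero = begin
    b zero * 1ℤ + sum (λ u → b (suc u) * 0ℤ)
      ≡⟨ cong₂ _+_ (ℤP.*-identityʳ (b zero)) (sum-zero (ℤP.*-zeroʳ ∘ b ∘ suc)) ⟩
    b zero + 0ℤ
      ≡⟨ ℤP.+-identityʳ (b zero) ⟩
    b zero ∎
    where open ≡-Reasoning
  sum-δ {m = suc m} b (suc v) = begin
    b zero * 0ℤ + sum (λ u → b (suc u) * δ u v) ≡⟨ cong₂ _+_ (ℤP.*-zeroʳ (b zero)) (sum-δ (b ∘ suc) v) ⟩
    0ℤ + b (suc v)                              ≡⟨ ℤP.+-identityˡ (b (suc v)) ⟩
    b (suc v)                                   ∎
    where open ≡-Reasoning

  sum-δʳ : ∀ (c : Fin m) → sum (δ c) ≡ 1ℤ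
  sum-δʳ c = trans (sum-cong-≗ (λ v → trans (δ-comm c v) (sym (ℤP.*-identityˡ (δ v c)))))
                   (sum-δ (const 1ℤ) c)

  sum-∣pre∣ : ∀ (φ : Fin a → Fin b) → sum (λ v → + ∣ pre φ v ∣) ≡ + a
  sum-∣pre∣ {a = zero} {b} φ = sum-replicate-zero b
  sum-∣pre∣ {a = suc a} φ = begin
    sum (λ v → + ∣ pre φ v ∣)
      ≡⟨ sum-cong-≗ split-head ⟩
    sum (λ v → δ (φ zero) v + + ∣ pre (φ ∘ suc) v ∣)
      ≡⟨ ∑-distrib-+ (δ (φ zero)) _ ⟩
    sum (δ (φ zero)) + sum (λ v → + ∣ pre (φ ∘ suc) v ∣)
      ≡⟨ cong₂ _+_ (sum-δʳ (φ zero)) (sum-∣pre∣ (φ ∘ suc)) ⟩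
    + suc a ∎
    where
    open ≡-Reasoning
    split-head : ∀ v → + ∣ pre φ v ∣ ≡ δ (φ zero) v + + ∣ pre (φ ∘ suc) v ∣
    split-head v with φ zero ≟ v
    ... | yes _ = refl
    ... | no _ = refl

  module Lattice (F R : Graph) where

    private
      L : (Fin (n R) → ℤ) → Set
      L = InLattice F R

      variable
        w w′ : Fin (n R) → ℤ
        x y z : Fin (n R)

    combination : List (ℤ × Hom F R) → Fin (n R) → ℤ
    combination cs v = sumℤ (map (λ p → proj₁ p * ind F R (proj₂ p) v) cs)

    combination-++ : ∀ cs ds v → combination (cs ++ ds) v ≡ combination cs v + combination ds v
    combination-++ [] ds v = sym (ℤP.+-identityˡ _)
    combination-++ ((c , h) ∷ cs) ds v =
      trans (cong (_+_ (c * ind F R h v)) (combination-++ cs ds v))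
            (sym (ℤP.+-assoc (c * ind F R h v) (combination cs v) (combination ds v)))

    combination-scale : ∀ z cs v → combination (map (Product.map₁ (z *_)) cs) v ≡ z * combination cs v
    combination-scale z [] v = sym (ℤP.*-zeroʳ z)
    combination-scale z ((c , h) ∷ cs) v =
      trans (cong₂ _+_ (ℤP.*-assoc z c _) (combination-scale z cs v)) (sym (ℤP.*-distribˡ-+ z _ _))

    L-resp : (∀ v → w v ≡ w′ v) → L w → L w′
    L-resp w≗w′ (cs , w≗cs) = cs , λ v → trans (sym (w≗w′ v)) (w≗cs v)

    0∈L : L (const 0ℤ)
    0∈L = [] , λ _ → refl

    ind∈L : ∀ h → L (ind F R h)
    ind∈L h = (1ℤ , h) ∷ [] , λ v → sym (trans (ℤP.+-identityʳ _) (ℤP.*-identityˡ _))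

    +-closed : L w → L w′ → L (λ v → w v + w′ v)
    +-closed (cs , w≗cs) (ds , w′≗ds) =
      cs ++ ds , λ v → trans (cong₂ _+_ (w≗cs v) (w′≗ds v)) (sym (combination-++ cs ds v))

    *-closed : ∀ z → L w → L (λ v → z * w v)
    *-closed z (cs , w≗cs) = map (Product.map₁ (z *_)) cs , λ v →
      trans (cong (z *_) (w≗cs v)) (sym (combination-scale z cs v))

    −-closed : L w → L w′ → L (λ v → w v - w′ v)
    −-closed {w′ = w′} w∈L w′∈L =
      +-closed w∈L (L-resp (λ v → ℤP.-1*i≡-i (w′ v)) (*-closed -1ℤ w′∈L))

    sum-closed : ∀ {j} (G : Fin j → Fin (n R) → ℤ) → (∀ u → L (G u)) →
                 L (λ v → sum (λ u → G u v))
    sum-closed {zero} G G∈L = 0∈L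
    sum-closed {suc j} G G∈L = +-closed (G∈L zero) (sum-closed (G ∘ suc) (G∈L ∘ suc))

    record _∼_ (x y : Fin (n R)) : Set where
      constructor difference∈L
      field ∈L : L (λ v → δ x v - δ y v)

    open _∼_

    ∼-refl : x ∼ x
    ∼-refl {x} = difference∈L (L-resp (λ v → sym (ℤP.+-inverseʳ (δ x v))) 0∈L)

    ∼-trans : x ∼ y → y ∼ z → x ∼ z
    ∼-trans {x} {y} {z} x∼y y∼z =
      difference∈L (L-resp (λ v → telescope (δ x v) (δ y v) (δ z v)) (+-closed (∈L x∼y) (∈L y∼z)))
      where
      telescope : ∀ a b c → a - b + (b - c) ≡ a - c
      telescope = solve-∀

    module _ {ℓ} (1≤ℓ : 1 ≤ ℓ)
             (edge-∼ : ∀ {f x y} → f ∈E E R → x ∈ f → y ∈ f → x ∼ y) where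

      walk-∼ : ∀ {e f x y} → LWalk ℓ (E R) e f → e ∈E E R → x ∈ e → y ∈ f → x ∼ y
      walk-∼ here e∈R x∈e y∈e = edge-∼ e∈R x∈e y∈e
      walk-∼ {e} (step {g = g} g∈R ℓ≤∣e∩g∣ walk) e∈R x∈e y∈f
        with z , z∈e∩g ← ∣p∣>0⇒nonempty (≤-trans 1≤ℓ ℓ≤∣e∩g∣) =
        ∼-trans (edge-∼ e∈R x∈e (proj₁ (x∈p∩q⁻ e g z∈e∩g)))
                (walk-∼ walk g∈R (proj₂ (x∈p∩q⁻ e g z∈e∩g)) y∈f)

    module _ (v₀ : Fin (n R)) (∼v₀ : ∀ u → u ∼ v₀) where

      reduced : (Fin (n R) → ℤ) → Fin (n R) → ℤ
      reduced b v = sum (λ u → b u * (δ u v - δ v₀ v))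

      reduced∈L : ∀ b → L (reduced b)
      reduced∈L b = sum-closed _ (λ u → *-closed (b u) (∈L (∼v₀ u)))

      reduced-decomposition : ∀ b v → reduced b v + sum b * δ v₀ v ≡ b v
      reduced-decomposition b v = begin
        sum (λ u → b u * (δ u v - δ v₀ v)) + sum b * δ v₀ v
          ≡⟨ cong (_+ sum b * δ v₀ v)
                  (sum-cong-≗ (λ u → ℤP.*-distribˡ-+ (b u) (δ u v) (- δ v₀ v))) ⟩
        sum (λ u → b u * δ u v + b u * - δ v₀ v) + sum b * δ v₀ v
          ≡⟨ cong (_+ sum b * δ v₀ v) (∑-distrib-+ (λ u → b u * δ u v) (λ u → b u * - δ v₀ v)) ⟩
        sum (λ u → b u * δ u v) + sum (λ u → b u * - δ v₀ v) + sum b * δ v₀ v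
          ≡⟨ cong₂ (λ s t → s + t + sum b * δ v₀ v)
                   (sum-δ b v) (sym (*-distribʳ-sum (- δ v₀ v) b)) ⟩
        b v + sum b * - δ v₀ v + sum b * δ v₀ v
          ≡⟨ cancel (b v) (sum b) (δ v₀ v) ⟩
        b v ∎
        where
        open ≡-Reasoning
        cancel : ∀ x s c → x + s * - c + s * c ≡ x
        cancel = solve-∀

      total∈L : L w → L (λ v → sum w * δ v₀ v)
      total∈L {w} w∈L = L-resp remainder (−-closed w∈L (reduced∈L w))
        where
        cancel : ∀ r s → r + s - r ≡ s
        cancel = solve-∀
        remainder : ∀ v → w v - reduced w v ≡ sum w * δ v₀ v
        remainder v = trans (cong (_- reduced w v) (sym (reduced-decomposition w v)))
                            (cancel (reduced w v) (sum w * δ v₀ v))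

      complete-from-differences : Hom F R → Complete F R
      complete-from-differences h b nF∣Σb with Signed.∣ᵤ⇒∣ nF∣Σb
      ... | Signed.divides q Σb≡q*nF = L-resp (reduced-decomposition b) (+-closed (reduced∈L b) multiple∈L)
        where
        Σb≡q*Σh : sum b ≡ q * sum (ind F R h)
        Σb≡q*Σh = trans (sym (sumℤ-map-tabulate b id))
                        (trans Σb≡q*nF (cong (q *_) (sym (sum-∣pre∣ (proj₁ h)))))
        multiple∈L : L (λ v → sum b * δ v₀ v)
        multiple∈L = L-resp (λ v → trans (sym (ℤP.*-assoc q _ _)) (cong (_* δ v₀ v) (sym Σb≡q*Σh)))
                            (*-closed q (total∈L (ind∈L h)))

  module RainbowLattice (C R : Graph) (φ : Fin (n C) → Fin k) (rainbow : Rainbow C φ) {c₁ c₂ : Fin k}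
                        (sizes : ∣ pre φ c₁ ∣ ≡ suc ∣ pre φ c₂ ∣) where

    open Lattice C R

    ind-rainbow-hom : ∀ {f} (β : Enumeration k f) (f∈R : f ∈E E R) c →
                      ind C R (rainbow-hom C φ rainbow R β f∈R) (point β c) ≡ + ∣ pre φ c ∣
    ind-rainbow-hom β f∈R c = cong (+_ ∘ ∣_∣) (pre-∘-injective φ (point-injective β) c)

    c₁≢c₂ : c₁ ≢ c₂
    c₁≢c₂ refl = 1+n≢n (sym sizes)

    -- h and h′ differ by the transposition of the colours c₁ and c₂, so their indicator
    -- vectors agree except at x and y, where they differ by ±(∣ pre φ c₁ ∣ − ∣ pre φ c₂ ∣) = ±1.
    swap-∼ : ∀ {f} (β : Enumeration k f) → f ∈E E R → point β c₁ ∼ point β c₂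
    swap-∼ β f∈R = difference∈L (L-resp difference (−-closed (ind∈L h) (ind∈L h′)))
      where
      β′ = permute β (transpose c₁ c₂)
      h = rainbow-hom C φ rainbow R β f∈R
      h′ = rainbow-hom C φ rainbow R β′ f∈R
      x = point β c₁
      y = point β c₂
      x≢y : x ≢ y
      x≢y = c₁≢c₂ ∘ point-injective β
      β′c₂≡x : point β′ c₂ ≡ x
      β′c₂≡x = cong (point β) (transpose-matchʳ c₁ c₂)
      β′c₁≡y : point β′ c₁ ≡ y
      β′c₁≡y = cong (point β) (transpose-matchˡ c₁ c₂)
      β≡v⇔β′≡v : ∀ {v} → x ≢ v → y ≢ v → ∀ c → point β c ≡ v ⇔ point β′ c ≡ v
      β≡v⇔β′≡v {v} x≢v y≢v c = by-cases (c ≟ c₁) (c ≟ c₂)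
        where
        by-cases : Dec (c ≡ c₁) → Dec (c ≡ c₂) → point β c ≡ v ⇔ point β′ c ≡ v
        by-cases (yes refl) _ = mk⇔ (λ x≡v → contradiction x≡v x≢v)
                                    (λ β′c₁≡v → contradiction (trans (sym β′c₁≡y) β′c₁≡v) y≢v)
        by-cases (no _) (yes refl) = mk⇔ (λ y≡v → contradiction y≡v y≢v)
                                         (λ β′c₂≡v → contradiction (trans (sym β′c₂≡x) β′c₂≡v) x≢v)
        by-cases (no c≢c₁) (no c≢c₂) rewrite transpose-mismatch c≢c₁ c≢c₂ = mk⇔ id id
      cancel⁺ : ∀ s → 1ℤ + s - s ≡ 1ℤ
      cancel⁺ = solve-∀
      cancel⁻ : ∀ s → s - (1ℤ + s) ≡ -1ℤ
      cancel⁻ = solve-∀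
      difference : ∀ v → ind C R h v - ind C R h′ v ≡ δ x v - δ y v
      difference v with x ≟ v | y ≟ v
      ... | yes refl | yes y≡x = contradiction (sym y≡x) x≢y
      ... | yes refl | no _ = begin
        ind C R h x - ind C R h′ x
          ≡⟨ cong₂ _-_ (ind-rainbow-hom β f∈R c₁)
                       (trans (cong (ind C R h′) (sym β′c₂≡x)) (ind-rainbow-hom β′ f∈R c₂)) ⟩
        + ∣ pre φ c₁ ∣ - + ∣ pre φ c₂ ∣
          ≡⟨ cong (λ s → + s - + ∣ pre φ c₂ ∣) sizes ⟩
        1ℤ + + ∣ pre φ c₂ ∣ - + ∣ pre φ c₂ ∣
          ≡⟨ cancel⁺ (+ ∣ pre φ c₂ ∣) ⟩
        1ℤ ∎
        where open ≡-Reasoning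
      ... | no _ | yes refl = begin
        ind C R h y - ind C R h′ y
          ≡⟨ cong₂ _-_ (ind-rainbow-hom β f∈R c₂)
                       (trans (cong (ind C R h′) (sym β′c₁≡y)) (ind-rainbow-hom β′ f∈R c₁)) ⟩
        + ∣ pre φ c₂ ∣ - + ∣ pre φ c₁ ∣
          ≡⟨ cong (λ s → + ∣ pre φ c₂ ∣ - + s) sizes ⟩
        + ∣ pre φ c₂ ∣ - (1ℤ + + ∣ pre φ c₂ ∣)
          ≡⟨ cancel⁻ (+ ∣ pre φ c₂ ∣) ⟩
        -1ℤ ∎
        where open ≡-Reasoning
      ... | no x≢v | no y≢v = begin
        ind C R h v - ind C R h′ v
          ≡⟨ cong (λ p → + ∣ p ∣ - ind C R h′ v) (pre-cong (β≡v⇔β′≡v x≢v y≢v ∘ φ)) ⟩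
        ind C R h′ v - ind C R h′ v
          ≡⟨ ℤP.+-inverseʳ (ind C R h′ v) ⟩
        0ℤ ∎
        where open ≡-Reasoning

    edge-∼ : ∀ {f x y} → f ∈E E R → ∣ f ∣ ≡ k → x ∈ f → y ∈ f → x ∼ y
    edge-∼ f∈R ∣f∣≡k x∈f y∈f with β ← enumerate-sized ∣f∣≡k
      with a , refl ← ∈⇒point β x∈f | b , refl ← ∈⇒point β y∈f | a ≟ b
    ... | yes refl = ∼-refl
    ... | no a≢b with σ , σc₁≡a , σc₂≡b ← permutation-sending-pair c₁≢c₂ a≢b =
      subst₂ _∼_ (cong (point β) σc₁≡a) (cong (point β) σc₂≡b) (swap-∼ (permute β σ) f∈R)

  rainbow⇒complete : ∀ {ℓ} (C R : Graph) → 1 ≤ ℓ → Uniform k R → LConnected ℓ R →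
                     (φ : Fin (n C) → Fin k) → Rainbow C φ →
                     {c₁ c₂ : Fin k} → ∣ pre φ c₁ ∣ ≡ suc ∣ pre φ c₂ ∣ → Complete C R
  rainbow⇒complete C (mkGraph zero _) _ _ _ _ _ _ _ _ = [] , λ ()
  rainbow⇒complete C R@(mkGraph (suc _) _) 1≤ℓ uniform (covered , connected) φ rainbow sizes
    with f₀ , f₀∈R , zero∈f₀ ← find (covered zero) =
    complete-from-differences zero ∼zero
      (rainbow-hom C φ rainbow R (enumerate-sized (All.lookup uniform f₀∈R)) f₀∈R)
    where
    open Lattice C R
    open RainbowLattice C R φ rainbow sizes
    ∼zero : ∀ u → u ∼ zero
    ∼zero u with f , f∈R , u∈f ← find (covered u) =
      walk-∼ 1≤ℓ (λ f∈R → edge-∼ f∈R (All.lookup uniform f∈R))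
             (connected f f₀ f∈R f₀∈R) f∈R u∈f zero∈f₀

module Cycles where

  open Enumerations
  open import Data.Bool.Properties using (T-≡)
  open import Data.Fin.Base using (Fin; zero; suc; toℕ; fromℕ<)
  open import Data.Fin.Permutation as Perm using (Permutation′; _⟨$⟩ʳ_; transpose)
  open import Data.Fin.Properties using (toℕ-fromℕ<; toℕ<n; toℕ-injective)
  open import Data.Fin.Subset using (Subset; _∈_; _∩_; ∣_∣)
  open import Data.Fin.Subset.Properties using (x∈p∩q⁺; x∈p∩q⁻)
  open import Data.List.Relation.Unary.All using (All)
  import Data.List.Relation.Unary.All.Properties as All
  open import Data.Nat.Base
  open import Data.Nat.DivMod
  open import Data.Nat.Divisibility using (_∣_; divides; n∣m*n; m∣m*n; 1∣_; m%n≡0⇒n∣m)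
  open import Data.Nat.Properties
  open import Data.Product.Base using (∃; _×_; _,_; proj₁; proj₂)
  open import Function.Base using (_∘_)
  open import Function.Bundles using (_⇔_; mk⇔; Equivalence)
  open import Function.Definitions using (Injective)
  open import Relation.Binary.PropositionalEquality
  open import Relation.Nullary using (Dec; yes; no; ¬_; contradiction)
  open import Relation.Nullary.Decidable using (dec-true)

  open Enumeration

  mod′≡% : ∀ x M .{{_ : NonZero M}} → x mod' M ≡ x % M
  mod′≡% x (suc M) = refl

  m≡m/n*n+m%n : ∀ m n .{{_ : NonZero n}} → m ≡ m / n * n + m % n
  m≡m/n*n+m%n m n = trans (m≡m%n+[m/n]*n m n) (+-comm (m % n) _)

  [m%d+n]%d≡[m+n]%d : ∀ m n d .{{_ : NonZero d}} → (m % d + n) % d ≡ (m + n) % d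
  [m%d+n]%d≡[m+n]%d m n d = begin
    (m % d + n) % d         ≡⟨ %-distribˡ-+ (m % d) n d ⟩
    (m % d % d + n % d) % d ≡⟨ cong (λ x → (x + n % d) % d) (m%n%n≡m%n m d) ⟩
    (m % d + n % d) % d     ≡⟨ %-distribˡ-+ m n d ⟨
    (m + n) % d             ∎
    where open ≡-Reasoning

  digits-injective : ∀ d {a a′ x x′} → x < d → x′ < d → a * d + x ≡ a′ * d + x′ → a ≡ a′ × x ≡ x′
  digits-injective d {a} {a′} {x} {x′} x<d x′<d eq = a≡a′ , x≡x′
    where
    instance
      d-nonZero : NonZero d
      d-nonZero = >-nonZero (≤-<-trans z≤n x<d)
    x≡x′ : x ≡ x′
    x≡x′ = begin
      x                 ≡⟨ m<n⇒m%n≡m x<d ⟨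
      x % d             ≡⟨ [m+kn]%n≡m%n x a d ⟨
      (x + a * d) % d   ≡⟨ cong (_% d) (trans (+-comm x _) (trans eq (+-comm _ x′))) ⟩
      (x′ + a′ * d) % d ≡⟨ [m+kn]%n≡m%n x′ a′ d ⟩
      x′ % d            ≡⟨ m<n⇒m%n≡m x′<d ⟩
      x′                ∎
      where open ≡-Reasoning
    a≡a′ : a ≡ a′
    a≡a′ = *-cancelʳ-≡ a a′ d (+-cancelʳ-≡ x _ _ (trans eq (cong (a′ * d +_) (sym x≡x′))))

  module Offset (M : ℕ) .{{_ : NonZero M}} where

    -- how far v lies beyond s, cyclically modulo M (this is the expression tested by cycEdge)
    offset : ℕ → ℕ → ℕ
    offset s v = (v + M ∸ s % M) % M

    s+[M∸s%M]≡[1+s/M]*M : ∀ s → s + (M ∸ s % M) ≡ suc (s / M) * M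
    s+[M∸s%M]≡[1+s/M]*M s = begin
      s + (M ∸ s % M)                   ≡⟨ cong (_+ (M ∸ s % M)) (m≡m/n*n+m%n s M) ⟩
      s / M * M + s % M + (M ∸ s % M)   ≡⟨ +-assoc (s / M * M) (s % M) _ ⟩
      s / M * M + (s % M + (M ∸ s % M)) ≡⟨ cong (s / M * M +_) (m+[n∸m]≡n (m%n≤n s M)) ⟩
      s / M * M + M                     ≡⟨ +-comm (s / M * M) M ⟩
      suc (s / M) * M                   ∎
      where open ≡-Reasoning

    [t+s+[M∸s%M]]%M≡t%M : ∀ s t → (t + (s + (M ∸ s % M))) % M ≡ t % M
    [t+s+[M∸s%M]]%M≡t%M s t =
      trans (cong (λ x → (t + x) % M) (s+[M∸s%M]≡[1+s/M]*M s)) ([m+kn]%n≡m%n t (suc (s / M)) M)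

    offset-shift : ∀ s {t} → t < M → offset s ((s + t) % M) ≡ t
    offset-shift s {t} t<M = begin
      ((s + t) % M + M ∸ s % M) % M   ≡⟨ cong (_% M) (+-∸-assoc ((s + t) % M) (m%n≤n s M)) ⟩
      ((s + t) % M + (M ∸ s % M)) % M ≡⟨ [m%d+n]%d≡[m+n]%d (s + t) _ M ⟩
      (s + t + (M ∸ s % M)) % M       ≡⟨ cong (λ x → (x + (M ∸ s % M)) % M) (+-comm s t) ⟩
      (t + s + (M ∸ s % M)) % M       ≡⟨ cong (_% M) (+-assoc t s _) ⟩
      (t + (s + (M ∸ s % M))) % M     ≡⟨ [t+s+[M∸s%M]]%M≡t%M s t ⟩
      t % M                           ≡⟨ m<n⇒m%n≡m t<M ⟩
      t                               ∎
      where open ≡-Reasoning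

    shift-offset : ∀ s {v} → v < M → (s + offset s v) % M ≡ v
    shift-offset s {v} v<M = begin
      (s + (v + M ∸ s % M) % M) % M   ≡⟨ trans (cong (_% M) (+-comm s _)) ([m%d+n]%d≡[m+n]%d _ s M) ⟩
      (v + M ∸ s % M + s) % M         ≡⟨ cong (λ x → (x + s) % M) (+-∸-assoc v (m%n≤n s M)) ⟩
      (v + (M ∸ s % M) + s) % M       ≡⟨ cong (_% M) (trans (+-assoc v _ s) (cong (v +_) (+-comm _ s))) ⟩
      (v + (s + (M ∸ s % M))) % M     ≡⟨ [t+s+[M∸s%M]]%M≡t%M s v ⟩
      v % M                           ≡⟨ m<n⇒m%n≡m v<M ⟩
      v                               ∎
      where open ≡-Reasoning

    shift-injective : ∀ s {t t′} → t < M → t′ < M → (s + t) % M ≡ (s + t′) % M → t ≡ t′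
    shift-injective s {t} {t′} t<M t′<M eq =
      trans (sym (offset-shift s t<M)) (trans (cong (offset s) eq) (offset-shift s t′<M))

  module Quotient (k ℓ : ℕ) (ℓ<k : ℓ < k) where

    d : ℕ
    d = k ∸ ℓ

    0<d : 0 < d
    0<d = m<n⇒0<n∸m ℓ<k

    d+ℓ≡k : d + ℓ ≡ k
    d+ℓ≡k = m∸n+n≡m (<⇒≤ ℓ<k)

    instance
      d-nonZero : NonZero d
      d-nonZero = >-nonZero 0<d

    q r : ℕ
    q = k / d
    r = k % d

    instance
      q-nonZero : NonZero q
      q-nonZero = >-nonZero (m≥n⇒m/n>0 (m∸n≤m k ℓ))

    k≡q*d+r : k ≡ q * d + r
    k≡q*d+r = m≡m/n*n+m%n k d

    r<d : r < d
    r<d = m%n<n k d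

    k<[1+q]*d : k < suc q * d
    k<[1+q]*d = begin-strict
      k         ≡⟨ k≡q*d+r ⟩
      q * d + r <⟨ +-monoʳ-< (q * d) r<d ⟩
      q * d + d ≡⟨ +-comm (q * d) d ⟩
      suc q * d ∎
      where open ≤-Reasoning

  module Cycle (k ℓ m : ℕ) (ℓ<k : ℓ < k) (k+d≤N : k + (k ∸ ℓ) ≤ m * (k ∸ ℓ)) where

    open Quotient k ℓ ℓ<k public

    N : ℕ
    N = m * d

    k≤N : k ≤ N
    k≤N = ≤-trans (m≤m+n k d) k+d≤N

    instance
      N-nonZero : NonZero N
      N-nonZero = >-nonZero (<-≤-trans 0<d (≤-trans (m≤n+m d k) k+d≤N))
      m-nonZero : NonZero m
      m-nonZero = m*n≢0⇒m≢0 m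

    open Offset N

    all-edges : ∀ {P : Subset N → Set} → (∀ i → P (cycEdge k ℓ m (toℕ i))) → All P (E (cycle k ℓ m))
    all-edges P-edge = All.map⁺ (All.tabulate⁺ P-edge)

    window : ℕ → ℕ → Fin N
    window i j = (i * d + j) mod N

    toℕ-window : ∀ i j → toℕ (window i j) ≡ (i * d + j) % N
    toℕ-window i j = toℕ-fromℕ< _

    window-suc : ∀ i j → window (suc i) j ≡ window i (d + j)
    window-suc i j = cong (_mod N) (trans (cong (_+ j) (+-comm d (i * d))) (+-assoc (i * d) d j))

    offset-window : ∀ i {j} → j < N → offset (i * d) (toℕ (window i j)) ≡ j
    offset-window i j<N = trans (cong (offset (i * d)) (toℕ-window i _)) (offset-shift (i * d) j<N)

    window-offset : ∀ i (v : Fin N) → window i (offset (i * d) (toℕ v)) ≡ v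
    window-offset i v = toℕ-injective (trans (toℕ-window i _) (shift-offset (i * d) (toℕ<n v)))

    window-injective : ∀ i {j j′} → j < N → j′ < N → window i j ≡ window i j′ → j ≡ j′
    window-injective i j<N j′<N eq =
      trans (sym (offset-window i j<N)) (trans (cong (offset (i * d) ∘ toℕ) eq) (offset-window i j′<N))

    edge-offset : ∀ i (v : Fin N) → ((toℕ v + N) ∸ ((i * d) mod' N)) mod' N ≡ offset (i * d) (toℕ v)
    edge-offset i v = trans (mod′≡% (toℕ v + N ∸ (i * d) mod' N) N)
                            (cong (λ s → (toℕ v + N ∸ s) % N) (mod′≡% (i * d) N))

    ∈edge⁺ : ∀ i {v} → offset (i * d) (toℕ v) < k → v ∈ cycEdge k ℓ m i
    ∈edge⁺ i {v} offset<k =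
      ∈-tabulate⁺ (dec-true (_ <? k) (subst (_< k) (sym (edge-offset i v)) offset<k))

    ∈edge⁻ : ∀ i {v} → v ∈ cycEdge k ℓ m i → offset (i * d) (toℕ v) < k
    ∈edge⁻ i {v} v∈e =
      subst (_< k) (edge-offset i v) (<ᵇ⇒< _ k (Equivalence.from T-≡ (∈-tabulate⁻ v∈e)))

    window∈edge : ∀ i {j} → j < k → window i j ∈ cycEdge k ℓ m i
    window∈edge i j<k = ∈edge⁺ i (subst (_< k) (sym (offset-window i (<-≤-trans j<k k≤N))) j<k)

    window-enumeration : ∀ {c} {p : Subset N} i → c ≤ N → (∀ {j} → j < c → window i j ∈ p) →
                         (∀ {v} → v ∈ p → offset (i * d) (toℕ v) < c) → Enumeration c p
    window-enumeration i c≤N window∈p ∈p⇒offset<c = record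
      { point = window i ∘ toℕ
      ; point-injective = λ eq →
          toℕ-injective (window-injective i (<-≤-trans (toℕ<n _) c≤N) (<-≤-trans (toℕ<n _) c≤N) eq)
      ; point∈ = λ j → window∈p (toℕ<n j)
      ; ∈⇒point = λ {v} v∈p →
          fromℕ< (∈p⇒offset<c v∈p) , trans (cong (window i) (toℕ-fromℕ< _)) (window-offset i v)
      }

    edge-enumeration : ∀ i → Enumeration k (cycEdge k ℓ m i)
    edge-enumeration i = window-enumeration i k≤N (window∈edge i) (∈edge⁻ i)

    meet-enumeration : ∀ i → Enumeration ℓ (cycEdge k ℓ m i ∩ cycEdge k ℓ m (suc i))
    meet-enumeration i = window-enumeration (suc i) (≤-trans (<⇒≤ ℓ<k) k≤N) window∈meet meet⇒offset<ℓ
      where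
      d+j<k : ∀ {j} → j < ℓ → d + j < k
      d+j<k {j} j<ℓ = subst (d + j <_) d+ℓ≡k (+-monoʳ-< d j<ℓ)
      window∈meet : ∀ {j} → j < ℓ → window (suc i) j ∈ cycEdge k ℓ m i ∩ cycEdge k ℓ m (suc i)
      window∈meet {j} j<ℓ =
        x∈p∩q⁺ ( subst (_∈ cycEdge k ℓ m i) (sym (window-suc i j)) (window∈edge i (d+j<k j<ℓ))
               , window∈edge (suc i) (<-trans j<ℓ ℓ<k))
      meet⇒offset<ℓ : ∀ {v} → v ∈ cycEdge k ℓ m i ∩ cycEdge k ℓ m (suc i) →
                      offset (suc i * d) (toℕ v) < ℓ
      meet⇒offset<ℓ {v} v∈meet =
        +-cancelˡ-< d _ _ (subst (_< d + ℓ) j≡d+j′ (subst (j <_) (sym d+ℓ≡k) j<k))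
        where
        j = offset (i * d) (toℕ v)
        j′ = offset (suc i * d) (toℕ v)
        j<k : j < k
        j<k = ∈edge⁻ i (proj₁ (x∈p∩q⁻ _ _ v∈meet))
        j′<k : j′ < k
        j′<k = ∈edge⁻ (suc i) (proj₂ (x∈p∩q⁻ _ _ v∈meet))
        j≡d+j′ : j ≡ d + j′
        j≡d+j′ = window-injective i (<-≤-trans j<k k≤N)
          (<-≤-trans (+-monoʳ-< d j′<k) (subst (_≤ N) (+-comm k d) k+d≤N)) (begin
            window i j         ≡⟨ window-offset i v ⟩
            v                  ≡⟨ window-offset (suc i) v ⟨
            window (suc i) j′  ≡⟨ window-suc i j′ ⟩
            window i (d + j′)  ∎)
          where open ≡-Reasoning

    uniform : Uniform k (cycle k ℓ m)
    uniform = all-edges (λ i → enumeration-size (edge-enumeration (toℕ i)))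

    consecutive-meet : ConsecutiveMeet k ℓ m
    consecutive-meet i _ = enumeration-size (meet-enumeration i)

  module Colouring (k ℓ m : ℕ) (ℓ<k : ℓ < k) (k+d≤N : k + (k ∸ ℓ) ≤ m * (k ∸ ℓ)) where

    open Cycle k ℓ m ℓ<k k+d≤N public

    period : ℕ → ℕ
    period s with s <? r
    ... | yes _ = suc q
    ... | no _ = q

    instance
      period-nonZero : ∀ {s} → NonZero (period s)
      period-nonZero {s} with s <? r
      ... | yes _ = _
      ... | no _ = q-nonZero

    period-< : ∀ {s} → s < r → period s ≡ suc q
    period-< {s} s<r with s <? r
    ... | yes _ = refl
    ... | no s≮r = contradiction s<r s≮r

    period-≥ : ∀ {s} → r ≤ s → period s ≡ q
    period-≥ {s} r≤s with s <? r
    ... | yes s<r = contradiction r≤s (<⇒≱ s<r)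
    ... | no _ = refl

    digit-bound : ∀ {c s} → s < d → c < period s → c * d + s < k
    digit-bound {c} {s} s<d c<period with s <? r
    ... | yes s<r = begin-strict
      c * d + s <⟨ +-monoʳ-< (c * d) s<r ⟩
      c * d + r ≤⟨ +-monoˡ-≤ r (*-monoˡ-≤ d (s≤s⁻¹ c<period)) ⟩
      q * d + r ≡⟨ k≡q*d+r ⟨
      k         ∎
      where open ≤-Reasoning
    ... | no _ = begin-strict
      c * d + s <⟨ +-monoʳ-< (c * d) s<d ⟩
      c * d + d ≡⟨ +-comm (c * d) d ⟩
      suc c * d ≤⟨ *-monoˡ-≤ d c<period ⟩
      q * d     ≤⟨ m≤m+n (q * d) r ⟩
      q * d + r ≡⟨ k≡q*d+r ⟨
      k         ∎
      where open ≤-Reasoning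

    period-bound : ∀ {j} → j < k → j / d < period (j % d)
    period-bound {j} j<k with j % d <? r
    ... | yes _ = m<n*o⇒m/o<n (<-trans j<k k<[1+q]*d)
    ... | no s≮r = *-cancelʳ-< d (j / d) q (+-cancelʳ-< (j % d) (j / d * d) (q * d) (begin-strict
      j / d * d + j % d ≡⟨ m≡m/n*n+m%n j d ⟨
      j                 <⟨ j<k ⟩
      k                 ≡⟨ k≡q*d+r ⟩
      q * d + r         ≤⟨ +-monoʳ-≤ (q * d) (≮⇒≥ s≮r) ⟩
      q * d + j % d     ∎))
      where open ≤-Reasoning

    block pos : Fin N → ℕ
    block u = toℕ u / d
    pos u = toℕ u % d

    block<m : ∀ u → block u < m
    block<m u = m<n*o⇒m/o<n (toℕ<n u)

    pos<d : ∀ u → pos u < d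
    pos<d u = m%n<n (toℕ u) d

    colour : Fin N → Fin k
    colour u = fromℕ< (digit-bound (pos<d u) (m%n<n (block u) (period (pos u))))

    toℕ-colour : ∀ u → toℕ (colour u) ≡ block u % period (pos u) * d + pos u
    toℕ-colour u = toℕ-fromℕ< _

    block-window : ∀ i j → block (window i j) ≡ (i + j / d) % m
    block-window i j = begin
      toℕ (window i j) / d      ≡⟨ cong (_/ d) (toℕ-window i j) ⟩
      (i * d + j) % (m * d) / d ≡⟨ m%[n*o]/o≡m/o%n (i * d + j) m d ⟩
      (i * d + j) / d % m       ≡⟨ cong (_% m) (+-distrib-/-∣ˡ j (divides i refl)) ⟩
      (i * d / d + j / d) % m   ≡⟨ cong (λ x → (x + j / d) % m) (m*n/n≡m i d) ⟩
      (i + j / d) % m           ∎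
      where open ≡-Reasoning

    pos-window : ∀ i j → pos (window i j) ≡ j % d
    pos-window i j = begin
      toℕ (window i j) % d      ≡⟨ cong (_% d) (toℕ-window i j) ⟩
      (i * d + j) % (m * d) % d ≡⟨ m∣n⇒o%n%m≡o%m d (m * d) (i * d + j) (divides m refl) ⟩
      (i * d + j) % d           ≡⟨ cong (_% d) (+-comm (i * d) j) ⟩
      (j + i * d) % d           ≡⟨ [m+kn]%n≡m%n j i d ⟩
      j % d                     ∎
      where open ≡-Reasoning

    colour≡⇒ : ∀ {u c} → toℕ (colour u) ≡ c → block u % period (pos u) ≡ c / d × pos u ≡ c % d
    colour≡⇒ {u} {c} eq =
      digits-injective d (pos<d u) (m%n<n c d) (trans (sym (toℕ-colour u)) (trans eq (m≡m/n*n+m%n c d)))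

    vertex : ∀ {a s} → a < m → s < d → Fin N
    vertex {a} {s} a<m s<d = fromℕ< (begin-strict
      a * d + s <⟨ +-monoʳ-< (a * d) s<d ⟩
      a * d + d ≡⟨ +-comm (a * d) d ⟩
      suc a * d ≤⟨ *-monoˡ-≤ d a<m ⟩
      m * d     ∎)
      where open ≤-Reasoning

    toℕ-vertex : ∀ {a s} (a<m : a < m) (s<d : s < d) → toℕ (vertex a<m s<d) ≡ a * d + s
    toℕ-vertex a<m s<d = toℕ-fromℕ< _

    vertex-digits : ∀ {a s} (a<m : a < m) (s<d : s < d) →
                    block (vertex a<m s<d) ≡ a × pos (vertex a<m s<d) ≡ s
    vertex-digits {a} {s} a<m s<d = digits-injective d {a = block v} {a′ = a} (pos<d v) s<d
      (trans (sym (m≡m/n*n+m%n (toℕ v) d)) (toℕ-vertex a<m s<d))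
      where v = vertex a<m s<d

    block-vertex : ∀ {a s} (a<m : a < m) (s<d : s < d) → block (vertex a<m s<d) ≡ a
    block-vertex {a} {s} a<m s<d = proj₁ (vertex-digits a<m s<d)

    pos-vertex : ∀ {a s} (a<m : a < m) (s<d : s < d) → pos (vertex a<m s<d) ≡ s
    pos-vertex {a} {s} a<m s<d = proj₂ (vertex-digits a<m s<d)

    colour-vertex : ∀ {a s} (a<m : a < m) (s<d : s < d) →
                    toℕ (colour (vertex a<m s<d)) ≡ a % period s * d + s
    colour-vertex a<m s<d = trans (toℕ-colour _)
      (cong₂ (λ a s → a % period s * d + s) (block-vertex a<m s<d) (pos-vertex a<m s<d))

    vertex-unique : ∀ {a s} (a<m : a < m) (s<d : s < d) u → block u ≡ a → pos u ≡ s → vertex a<m s<d ≡ u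
    vertex-unique a<m s<d u refl refl =
      toℕ-injective (trans (toℕ-vertex a<m s<d) (sym (m≡m/n*n+m%n (toℕ u) d)))

    module _ (q∣m : q ∣ m) (1+q∣m : suc q ∣ m) where

      period∣m : ∀ s → period s ∣ m
      period∣m s with s <? r
      ... | yes _ = 1+q∣m
      ... | no _ = q∣m

      colour-window : ∀ i j → toℕ (colour (window i j)) ≡ (i + j / d) % period (j % d) * d + j % d
      colour-window i j = begin
        toℕ (colour w)
          ≡⟨ toℕ-colour w ⟩
        block w % period (pos w) * d + pos w
          ≡⟨ cong (λ s → block w % period s * d + s) (pos-window i j) ⟩
        block w % period (j % d) * d + j % d
          ≡⟨ cong (λ a → a % period (j % d) * d + j % d) (block-window i j) ⟩
        (i + j / d) % m % period (j % d) * d + j % d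
          ≡⟨ cong (λ a → a * d + j % d) (m∣n⇒o%n%m≡o%m (period (j % d)) m (i + j / d) (period∣m (j % d))) ⟩
        (i + j / d) % period (j % d) * d + j % d ∎
        where
        open ≡-Reasoning
        w = window i j

      window-colour-injective : ∀ i {j j′} → j < k → j′ < k →
                                colour (window i j) ≡ colour (window i j′) → j ≡ j′
      window-colour-injective i {j} {j′} j<k j′<k eq = begin
        j                     ≡⟨ m≡m/n*n+m%n j d ⟩
        j / d * d + j % d     ≡⟨ cong₂ (λ t s → t * d + s) t≡t′ s≡s′ ⟩
        j′ / d * d + j′ % d   ≡⟨ m≡m/n*n+m%n j′ d ⟨
        j′                    ∎
        where
        open ≡-Reasoning
        digits = digits-injective d (m%n<n j d) (m%n<n j′ d)
                   (trans (sym (colour-window i j)) (trans (cong toℕ eq) (colour-window i j′)))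
        s≡s′ : j % d ≡ j′ % d
        s≡s′ = proj₂ digits
        period≡ : period (j % d) ≡ period (j′ % d)
        period≡ = cong period s≡s′
        open Offset (period (j % d))
        t≡t′ : j / d ≡ j′ / d
        t≡t′ = shift-injective i (period-bound j<k) (subst (j′ / d <_) (sym period≡) (period-bound j′<k))
                 (trans (proj₁ digits) (%-congʳ (sym period≡)))

      rainbow : Rainbow (cycle k ℓ m) colour
      rainbow = all-edges λ i → edge-enumeration (toℕ i) , λ eq →
        toℕ-injective (window-colour-injective (toℕ i) (toℕ<n _) (toℕ<n _) eq)

      module ColourClass {c} (c<k : c < k) where

        p : ℕ
        p = period (c % d)

        c/d<p : c / d < p
        c/d<p = period-bound c<k

        m/p*p≡m : m / p * p ≡ m
        m/p*p≡m = m/n*n≡m (period∣m (c % d))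

        member-block<m : ∀ (j : Fin (m / p)) → toℕ j * p + c / d < m
        member-block<m j = begin-strict
          toℕ j * p + c / d <⟨ +-monoʳ-< (toℕ j * p) c/d<p ⟩
          toℕ j * p + p     ≡⟨ +-comm (toℕ j * p) p ⟩
          suc (toℕ j) * p   ≤⟨ *-monoˡ-≤ p (toℕ<n j) ⟩
          m / p * p         ≡⟨ m/p*p≡m ⟩
          m                 ∎
          where open ≤-Reasoning

        member : Fin (m / p) → Fin N
        member j = vertex (member-block<m j) (m%n<n c d)

        block-member : ∀ j → block (member j) ≡ toℕ j * p + c / d
        block-member j = block-vertex (member-block<m j) (m%n<n c d)

        member-injective : Injective _≡_ _≡_ member
        member-injective {i} {j} eq = toℕ-injective (*-cancelʳ-≡ (toℕ i) (toℕ j) p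
          (+-cancelʳ-≡ (c / d) (toℕ i * p) (toℕ j * p)
            (trans (sym (block-member i)) (trans (cong block eq) (block-member j)))))

        member-colour : ∀ j → colour (member j) ≡ fromℕ< c<k
        member-colour j = toℕ-injective (begin
          toℕ (colour (member j))             ≡⟨ colour-vertex (member-block<m j) (m%n<n c d) ⟩
          (toℕ j * p + c / d) % p * d + c % d ≡⟨ cong (λ a → a % p * d + c % d) (+-comm (toℕ j * p) (c / d)) ⟩
          (c / d + toℕ j * p) % p * d + c % d ≡⟨ cong (λ a → a * d + c % d) ([m+kn]%n≡m%n (c / d) (toℕ j) p) ⟩
          c / d % p * d + c % d               ≡⟨ cong (λ a → a * d + c % d) (m<n⇒m%n≡m c/d<p) ⟩
          c / d * d + c % d                   ≡⟨ m≡m/n*n+m%n c d ⟨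
          c                                   ≡⟨ toℕ-fromℕ< c<k ⟨
          toℕ (fromℕ< c<k)                    ∎)
          where open ≡-Reasoning

        colour⇒member : ∀ {u} → colour u ≡ fromℕ< c<k → ∃ λ j → member j ≡ u
        colour⇒member {u} colour≡c = j , vertex-unique (member-block<m j) (m%n<n c d) u block≡ pos≡
          where
          digits = colour≡⇒ (trans (cong toℕ colour≡c) (toℕ-fromℕ< c<k))
          pos≡ : pos u ≡ c % d
          pos≡ = proj₂ digits
          block/p<m/p : block u / p < m / p
          block/p<m/p = m<n*o⇒m/o<n (subst (block u <_) (sym m/p*p≡m) (block<m u))
          j : Fin (m / p)
          j = fromℕ< block/p<m/p
          block≡ : block u ≡ toℕ j * p + c / d
          block≡ = begin
            block u                              ≡⟨ m≡m/n*n+m%n (block u) p ⟩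
            block u / p * p + block u % p        ≡⟨ cong (λ t → t * p + block u % p) (toℕ-fromℕ< block/p<m/p) ⟨
            toℕ j * p + block u % p              ≡⟨ cong (toℕ j * p +_) (%-congʳ (cong period (sym pos≡))) ⟩
            toℕ j * p + block u % period (pos u) ≡⟨ cong (toℕ j * p +_) (proj₁ digits) ⟩
            toℕ j * p + c / d                    ∎
            where open ≡-Reasoning

      class-size : ∀ {c} (c<k : c < k) → ∣ pre colour (fromℕ< c<k) ∣ ≡ m / period (c % d)
      class-size c<k =
        enumeration-size (pre-enumeration colour member member-injective member-colour colour⇒member)
        where open ColourClass c<k

  record SkewRainbowCycle (k ℓ : ℕ) : Set where
    field
      m : ℕ
      m≤k⁴ : m ≤ k ^ 4
      proper : k + (k ∸ ℓ) ≤ m * (k ∸ ℓ)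
      colouring : Fin (n (cycle k ℓ m)) → Fin k
      rainbow : Rainbow (cycle k ℓ m) colouring
      c₁ c₂ : Fin k
      sizes : ∣ pre colouring c₁ ∣ ≡ suc ∣ pre colouring c₂ ∣

  k*k≤k^4 : ∀ k → k * k ≤ k ^ 4
  k*k≤k^4 zero = z≤n
  k*k≤k^4 (suc k) = *-monoʳ-≤ (suc k) (m≤m*n (suc k) (suc k * (suc k * 1)))

  module LargeQuotient (k ℓ : ℕ) (ℓ<k : ℓ < k) where

    open Quotient k ℓ ℓ<k

    module _ (0<r : 0 < r) (2≤q : 2 ≤ q) where

      m : ℕ
      m = q * suc q

      proper : k + d ≤ m * d
      proper = begin
        k + d           ≤⟨ +-monoˡ-≤ d (<⇒≤ k<[1+q]*d) ⟩
        suc q * d + d   ≡⟨ +-comm (suc q * d) d ⟩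
        suc (suc q) * d ≤⟨ *-monoˡ-≤ d 2+q≤m ⟩
        m * d           ∎
        where
        open ≤-Reasoning
        2+q≤m : 2 + q ≤ m
        2+q≤m = subst (2 + q ≤_) (sym (trans (*-suc q q) (+-comm q (q * q))))
                  (+-monoˡ-≤ q (≤-trans 2≤q (m≤m*n q q)))

      open Colouring k ℓ m ℓ<k proper
        using (colour; rainbow; class-size; period; period-nonZero; period-<; period-≥)

      q∣m : q ∣ m
      q∣m = m∣m*n (suc q)

      1+q∣m : suc q ∣ m
      1+q∣m = n∣m*n q

      r<k : r < k
      r<k = <-≤-trans r<d (m∸n≤m k ℓ)

      0<k : 0 < k
      0<k = <-trans 0<r r<k

      m/q≡1+q : m / q ≡ suc q
      m/q≡1+q = trans (/-congˡ (*-comm q (suc q))) (m*n/n≡m (suc q) q)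

      size-r : ∣ pre colour (fromℕ< r<k) ∣ ≡ suc q
      size-r = trans (class-size q∣m 1+q∣m r<k)
        (trans (/-congʳ (trans (cong period (m<n⇒m%n≡m r<d)) (period-≥ ≤-refl))) m/q≡1+q)

      size-0 : ∣ pre colour (fromℕ< 0<k) ∣ ≡ q
      size-0 = trans (class-size q∣m 1+q∣m 0<k)
        (trans (/-congʳ (trans (cong period (m<n⇒m%n≡m 0<d)) (period-< 0<r))) (m*n/n≡m q (suc q)))

      m≤k⁴ : m ≤ k ^ 4
      m≤k⁴ = ≤-trans (*-mono-≤ (m/n≤m k d) 1+q≤k) (k*k≤k^4 k)
        where
        1+q≤k : suc q ≤ k
        1+q≤k = begin
          suc q     ≡⟨ +-comm 1 q ⟩
          q + 1     ≤⟨ +-mono-≤ (m≤m*n q d) 0<r ⟩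
          q * d + r ≡⟨ k≡q*d+r ⟨
          k         ∎
          where open ≤-Reasoning

      skew-rainbow-cycle : SkewRainbowCycle k ℓ
      skew-rainbow-cycle = record
        { m = m
        ; m≤k⁴ = m≤k⁴
        ; proper = proper
        ; colouring = colour
        ; rainbow = rainbow q∣m 1+q∣m
        ; c₁ = fromℕ< r<k
        ; c₂ = fromℕ< 0<k
        ; sizes = trans size-r (cong suc (sym size-0))
        }

  module UnitQuotient (k ℓ : ℕ) (ℓ<k : ℓ < k) where

    open Quotient k ℓ ℓ<k

    module _ (0<r : 0 < r) (q≡1 : q ≡ 1) where

      proper : k + d ≤ 4 * d
      proper = begin
        k + d     ≤⟨ +-monoˡ-≤ d (<⇒≤ (subst (λ x → k < suc x * d) q≡1 k<[1+q]*d)) ⟩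
        2 * d + d ≡⟨ +-comm (2 * d) d ⟩
        3 * d     ≤⟨ *-monoˡ-≤ d (n≤1+n 3) ⟩
        4 * d     ∎
        where open ≤-Reasoning

      open Colouring k ℓ 4 ℓ<k proper
        using (N; window; block; pos; block<m; colour; toℕ-colour; colour≡⇒; block-window; pos-window;
               period; period-nonZero; period-<; period-≥; period-bound; vertex; block-vertex;
               colour-vertex; vertex-unique; window-colour-injective; class-size; all-edges; edge-enumeration)

      q∣4 : q ∣ 4
      q∣4 = subst (_∣ 4) (sym q≡1) (1∣_ 4)

      1+q∣4 : suc q ∣ 4
      1+q∣4 = subst (λ x → suc x ∣ 4) (sym q≡1) (divides 2 refl)

      period-small : ∀ {s} → s < r → period s ≡ 2
      period-small s<r = trans (period-< s<r) (cong suc q≡1)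

      period-large : ∀ {s} → r ≤ s → period s ≡ 1
      period-large r≤s = trans (period-≥ r≤s) q≡1

      period≤2 : ∀ s → period s ≤ 2
      period≤2 s with s <? r
      ... | yes _ = ≤-reflexive (cong suc q≡1)
      ... | no _ = ≤-trans (≤-reflexive q≡1) (n≤1+n 1)

      r<k : r < k
      r<k = <-≤-trans r<d (m∸n≤m k ℓ)

      r∸1<r : r ∸ 1 < r
      r∸1<r = ∸-monoʳ-< {r} {1} {0} (s≤s z≤n) 0<r

      d<k : d < k
      d<k = begin-strict
        d         <⟨ m<m+n d 0<r ⟩
        d + r     ≡⟨ cong (_+ r) (*-identityˡ d) ⟨
        1 * d + r ≡⟨ cong (λ x → x * d + r) q≡1 ⟨
        q * d + r ≡⟨ k≡q*d+r ⟨
        k         ∎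
        where open ≤-Reasoning

      X Y Z : Fin k
      X = fromℕ< (<-trans r∸1<r r<k)
      Y = fromℕ< d<k
      Z = fromℕ< r<k

      toℕ-X : toℕ X ≡ r ∸ 1
      toℕ-X = toℕ-fromℕ< _

      toℕ-Y : toℕ Y ≡ d
      toℕ-Y = toℕ-fromℕ< _

      toℕ-Z : toℕ Z ≡ r
      toℕ-Z = toℕ-fromℕ< _

      -- For q = 1 every colour class has 2 or 4 vertices.  Exchanging, in the blocks 0 and 3,
      -- the colour X of position r − 1 (in even blocks) with the colour Z of position r keeps
      -- every edge rainbow: an edge starting in block 1 or 3 ends in block 2 or 0, which is
      -- twisted like its first block, and an edge starting in block 0 or 2 ends in an odd
      -- block, whose colours are ≥ d and hence untouched.  Then Z has three vertices, while Y
      -- (position 0 in odd blocks) keeps two.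
      twist : ℕ → Permutation′ k
      twist 0 = transpose X Z
      twist 3 = transpose X Z
      twist _ = Perm.id

      twisted : Fin N → Fin k
      twisted u = twist (block u) ⟨$⟩ʳ colour u

      twisted-on-block : ∀ {u a} → block u ≡ a → twisted u ≡ twist a ⟨$⟩ʳ colour u
      twisted-on-block {u} block≡a = cong (λ a → twist a ⟨$⟩ʳ colour u) block≡a

      twist-fixes-high : ∀ a {c} → d ≤ toℕ c → twist a ⟨$⟩ʳ c ≡ c
      twist-fixes-high 0 {c} d≤c =
        transpose-mismatch (≢low X (subst (_< d) (sym toℕ-X) (<-trans r∸1<r r<d)))
                           (≢low Z (subst (_< d) (sym toℕ-Z) r<d))
        where
        ≢low : ∀ c′ → toℕ c′ < d → c ≢ c′
        ≢low c′ c′<d refl = <⇒≱ c′<d d≤c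
      twist-fixes-high 1 _ = refl
      twist-fixes-high 2 _ = refl
      twist-fixes-high 3 d≤c = twist-fixes-high 0 d≤c
      twist-fixes-high (suc (suc (suc (suc _)))) _ = refl

      high-colour : ∀ u → block u % 2 ≡ 1 → pos u < r → d ≤ toℕ (colour u)
      high-colour u block%2≡1 pos<r = begin
        d                                    ≡⟨ *-identityˡ d ⟨
        1 * d                                ≡⟨ cong (_* d) (trans (%-congʳ (period-small pos<r)) block%2≡1) ⟨
        block u % period (pos u) * d         ≤⟨ m≤m+n _ (pos u) ⟩
        block u % period (pos u) * d + pos u ≡⟨ toℕ-colour u ⟨
        toℕ (colour u)                       ∎
        where open ≤-Reasoning

      twisted-window : ∀ i {j} → i < 4 → j < k →
                       twisted (window i j) ≡ twist i ⟨$⟩ʳ colour (window i j)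
      twisted-window i {j} i<4 j<k = by-quotient (j / d) refl
        where
        u = window i j
        t<period : j / d < period (j % d)
        t<period = period-bound j<k
        next-block : ∀ i → i < 4 → block u ≡ (i + 1) % 4 → pos u < r →
                     twisted u ≡ twist i ⟨$⟩ʳ colour u
        next-block 0 _ block≡1 pos<r =
          trans (twisted-on-block block≡1)
                (sym (twist-fixes-high 0 (high-colour u (cong (_% 2) block≡1) pos<r)))
        next-block 1 _ block≡2 _ = twisted-on-block block≡2
        next-block 2 _ block≡3 pos<r =
          trans (twisted-on-block block≡3) (twist-fixes-high 3 (high-colour u (cong (_% 2) block≡3) pos<r))
        next-block 3 _ block≡0 _ = twisted-on-block block≡0
        next-block (suc (suc (suc (suc _)))) (s≤s (s≤s (s≤s (s≤s ())))) _ _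
        by-quotient : ∀ t → j / d ≡ t → twisted u ≡ twist i ⟨$⟩ʳ colour u
        by-quotient 0 t≡0 = twisted-on-block (begin
          block u         ≡⟨ block-window i j ⟩
          (i + j / d) % 4 ≡⟨ cong (λ t → (i + t) % 4) t≡0 ⟩
          (i + 0) % 4     ≡⟨ cong (_% 4) (+-identityʳ i) ⟩
          i % 4           ≡⟨ m<n⇒m%n≡m i<4 ⟩
          i               ∎)
          where open ≡-Reasoning
        by-quotient 1 t≡1 =
          next-block i i<4 (trans (block-window i j) (cong (λ t → (i + t) % 4) t≡1)) pos<r
          where
          pos<r : pos u < r
          pos<r with j % d <? r
          ... | yes s<r = subst (_< r) (sym (pos-window i j)) s<r
          ... | no s≮r = contradiction (subst₂ _<_ t≡1 (period-large (≮⇒≥ s≮r)) t<period) (<-irrefl refl)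
        by-quotient (suc (suc t)) t≡2+t =
          contradiction (<-≤-trans (subst (_< period (j % d)) t≡2+t t<period) (period≤2 (j % d)))
                        (≤⇒≯ (m≤m+n 2 t))

      twisted-rainbow : Rainbow (cycle k ℓ 4) twisted
      twisted-rainbow = all-edges λ i → edge-enumeration (toℕ i) , λ {j} {j′} eq →
        toℕ-injective (window-colour-injective q∣4 1+q∣4 (toℕ i) (toℕ<n j) (toℕ<n j′)
          (permutation-injective (twist (toℕ i)) (begin
            twist (toℕ i) ⟨$⟩ʳ colour (window (toℕ i) (toℕ j))
              ≡⟨ twisted-window (toℕ i) (toℕ<n i) (toℕ<n j) ⟨
            twisted (window (toℕ i) (toℕ j))
              ≡⟨ eq ⟩
            twisted (window (toℕ i) (toℕ j′))
              ≡⟨ twisted-window (toℕ i) (toℕ<n i) (toℕ<n j′) ⟩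
            twist (toℕ i) ⟨$⟩ʳ colour (window (toℕ i) (toℕ j′)) ∎)))
        where open ≡-Reasoning

      twisted≡Y⇔colour≡Y : ∀ u → twisted u ≡ Y ⇔ colour u ≡ Y
      twisted≡Y⇔colour≡Y u = mk⇔
        (λ twisted≡Y →
           permutation-injective (twist (block u)) (trans twisted≡Y (sym (Y-fixed (block u)))))
        (λ colour≡Y → trans (cong (twist (block u) ⟨$⟩ʳ_) colour≡Y) (Y-fixed (block u)))
        where
        Y-fixed : ∀ a → twist a ⟨$⟩ʳ Y ≡ Y
        Y-fixed a = twist-fixes-high a (≤-reflexive (sym toℕ-Y))

      size-Y : ∣ pre twisted Y ∣ ≡ 2
      size-Y = begin
        ∣ pre twisted Y ∣  ≡⟨ cong ∣_∣ (pre-cong twisted≡Y⇔colour≡Y) ⟩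
        ∣ pre colour Y ∣   ≡⟨ class-size q∣4 1+q∣4 d<k ⟩
        4 / period (d % d) ≡⟨ /-congʳ (trans (cong period (n%n≡0 d)) (period-small 0<r)) ⟩
        2                  ∎
        where open ≡-Reasoning

      corner-pos : Fin 3 → ℕ
      corner-pos zero = r ∸ 1
      corner-pos (suc _) = r

      corner-pos<d : ∀ j → corner-pos j < d
      corner-pos<d zero = <-trans r∸1<r r<d
      corner-pos<d (suc _) = r<d

      corner-block<4 : ∀ (j : Fin 3) → toℕ j < 4
      corner-block<4 j = <-trans (toℕ<n j) (n<1+n 3)

      corner : Fin 3 → Fin N
      corner j = vertex (corner-block<4 j) (corner-pos<d j)

      block-corner : ∀ j → block (corner j) ≡ toℕ j
      block-corner j = block-vertex (corner-block<4 j) (corner-pos<d j)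

      corner-injective : Injective _≡_ _≡_ corner
      corner-injective {i} {j} eq =
        toℕ-injective (trans (sym (block-corner i)) (trans (cong block eq) (block-corner j)))

      colour-corner : ∀ j → colour (corner (suc j)) ≡ Z
      colour-corner j = toℕ-injective (begin
        toℕ (colour (corner (suc j)))  ≡⟨ colour-vertex (corner-block<4 (suc j)) r<d ⟩
        toℕ (suc j) % period r * d + r ≡⟨ cong (λ a → a * d + r) (%-congʳ (period-large ≤-refl)) ⟩
        toℕ (suc j) % 1 * d + r        ≡⟨ cong (λ a → a * d + r) (n%1≡0 (toℕ (suc j))) ⟩
        r                              ≡⟨ toℕ-Z ⟨
        toℕ Z                          ∎)
        where open ≡-Reasoning

      corner-twisted : ∀ j → twisted (corner j) ≡ Z
      corner-twisted zero = begin
        twisted (corner zero)              ≡⟨ twisted-on-block (block-corner zero) ⟩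
        twist 0 ⟨$⟩ʳ colour (corner zero) ≡⟨ cong (twist 0 ⟨$⟩ʳ_) (toℕ-injective (begin
          toℕ (colour (corner zero))          ≡⟨ colour-vertex (corner-block<4 zero) (corner-pos<d zero) ⟩
          0 % period (r ∸ 1) * d + (r ∸ 1)    ≡⟨ cong (λ a → a * d + (r ∸ 1)) (%-congʳ (period-small r∸1<r)) ⟩
          r ∸ 1                               ≡⟨ toℕ-X ⟨
          toℕ X                               ∎)) ⟩
        twist 0 ⟨$⟩ʳ X                     ≡⟨ transpose-matchˡ X Z ⟩
        Z                                  ∎
        where open ≡-Reasoning
      corner-twisted (suc zero) =
        trans (twisted-on-block (block-corner (suc zero))) (colour-corner zero)
      corner-twisted (suc (suc zero)) =
        trans (twisted-on-block (block-corner (suc (suc zero)))) (colour-corner (suc zero))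

      colour≡X⇒ : ∀ {u} → colour u ≡ X → block u % 2 ≡ 0 × pos u ≡ r ∸ 1
      colour≡X⇒ {u} colour≡X = block%2≡0 , pos≡
        where
        r∸1<d = <-trans r∸1<r r<d
        digits = colour≡⇒ (trans (cong toℕ colour≡X) toℕ-X)
        pos≡ : pos u ≡ r ∸ 1
        pos≡ = trans (proj₂ digits) (m<n⇒m%n≡m r∸1<d)
        block%2≡0 : block u % 2 ≡ 0
        block%2≡0 = trans (%-congʳ (sym (trans (cong period pos≡) (period-small r∸1<r))))
                          (trans (proj₁ digits) (m<n⇒m/n≡0 r∸1<d))

      colour≡Z⇒ : ∀ {u} → colour u ≡ Z → pos u ≡ r
      colour≡Z⇒ colour≡Z = trans (proj₂ (colour≡⇒ (trans (cong toℕ colour≡Z) toℕ-Z))) (m<n⇒m%n≡m r<d)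

      twisted≡Z⇒corner : ∀ {u} → twisted u ≡ Z → ∃ λ j → corner j ≡ u
      twisted≡Z⇒corner {u} twisted≡Z = by-block (block u) refl (block<m u)
        where
        swapped : ∀ {a} → block u ≡ a → twist a ⟨$⟩ʳ X ≡ Z → colour u ≡ X
        swapped {a} block≡a X↦Z = permutation-injective (twist a)
          (trans (sym (twisted-on-block block≡a)) (trans twisted≡Z (sym X↦Z)))
        at : ∀ j → block u ≡ toℕ j → pos u ≡ corner-pos j → ∃ λ j → corner j ≡ u
        at j block≡ pos≡ = j , vertex-unique (corner-block<4 j) (corner-pos<d j) u block≡ pos≡
        by-block : ∀ a → block u ≡ a → a < 4 → ∃ λ j → corner j ≡ u
        unswapped : ∀ {a} → block u ≡ a → twist a ⟨$⟩ʳ Z ≡ Z → colour u ≡ Z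
        unswapped {a} block≡a Z↦Z = permutation-injective (twist a)
          (trans (sym (twisted-on-block block≡a)) (trans twisted≡Z (sym Z↦Z)))
        by-block 0 block≡0 _ = at zero block≡0 (proj₂ (colour≡X⇒ (swapped block≡0 (transpose-matchˡ X Z))))
        by-block 1 block≡1 _ = at (suc zero) block≡1 (colour≡Z⇒ (unswapped block≡1 refl))
        by-block 2 block≡2 _ = at (suc (suc zero)) block≡2 (colour≡Z⇒ (unswapped block≡2 refl))
        by-block 3 block≡3 _
          with () ← trans (sym (cong (_% 2) block≡3))
                          (proj₁ (colour≡X⇒ (swapped block≡3 (transpose-matchˡ X Z))))
        by-block (suc (suc (suc (suc _)))) _ (s≤s (s≤s (s≤s (s≤s ()))))

      size-Z : ∣ pre twisted Z ∣ ≡ 3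
      size-Z =
        enumeration-size (pre-enumeration twisted corner corner-injective corner-twisted twisted≡Z⇒corner)

      skew-rainbow-cycle : SkewRainbowCycle k ℓ
      skew-rainbow-cycle = record
        { m = 4
        ; m≤k⁴ = ≤-trans (*-mono-≤ 2≤k 2≤k) (k*k≤k^4 k)
        ; proper = proper
        ; colouring = twisted
        ; rainbow = twisted-rainbow
        ; c₁ = Z
        ; c₂ = Y
        ; sizes = trans size-Z (cong suc (sym size-Y))
        }
        where
        2≤k : 2 ≤ k
        2≤k = <-≤-trans (s≤s 0<d) d<k

  skew-rainbow-cycle : ∀ {k ℓ} → ℓ < k → ¬ (k ∸ ℓ) ∣ k → SkewRainbowCycle k ℓ
  skew-rainbow-cycle {k} {ℓ} ℓ<k d∤k = by-quotient (q ≟ 1)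
    where
    open Quotient k ℓ ℓ<k
    0<r : 0 < r
    0<r = n≢0⇒n>0 (d∤k ∘ m%n≡0⇒n∣m k d)
    by-quotient : Dec (q ≡ 1) → SkewRainbowCycle k ℓ
    by-quotient (yes q≡1) = UnitQuotient.skew-rainbow-cycle k ℓ ℓ<k 0<r q≡1
    by-quotient (no q≢1) =
      LargeQuotient.skew-rainbow-cycle k ℓ ℓ<k 0<r (≤∧≢⇒< (>-nonZero⁻¹ q) (q≢1 ∘ sym))

open Enumerations using (rainbow⇒kPartite)
open Lattices using (rainbow⇒complete)
open Cycles using (SkewRainbowCycle; skew-rainbow-cycle; module Cycle)

lemma5p1 : (k ℓ : ℕ) → 1 ≤ ℓ → ℓ < k → ¬ ((k ∸ ℓ) ∣ k) →
    (R : Graph) → Uniform k R → LConnected ℓ R →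
    Σ ℕ λ m → 1 ≤ m × m ≤ k ^ 4 ×
      Uniform k (cycle k ℓ m) × ConsecutiveMeet k ℓ m ×
      KPartite k (cycle k ℓ m) × Complete (cycle k ℓ m) R
lemma5p1 k ℓ 1≤ℓ ℓ<k d∤k R uniform-R connected-R =
  m , >-nonZero⁻¹ m , m≤k⁴ , uniform , consecutive-meet ,
  rainbow⇒kPartite (cycle k ℓ m) colouring rainbow ,
  rainbow⇒complete (cycle k ℓ m) R 1≤ℓ uniform-R connected-R colouring rainbow sizes
  where
  open SkewRainbowCycle (skew-rainbow-cycle ℓ<k d∤k)
  open Cycle k ℓ m ℓ<k proper using (uniform; consecutive-meet; m-nonZero)
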